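{- For $n\ge 1$, let $g_{n,5}$ denote the number of standard Young tableaux of truncated shifted shape with $n$ rows and $5$ boxes in each row. Then $g_{1,5}=1$, $g_{2,5}=14$, $g_{3,5}=290$, and for all $n\ge 4$, $$g_{n,5}=24g_{n-1,5}-40g_{n-2,5}-8g_{n-3,5}.$$
   Context: The truncated shifted shape with $n$ rows and $k$ boxes in each row is the set of boxes $(i,c)$ with $1\le i\le n$ and $i\le c\le i+k-1$ (row $i$ consists of $k$ consecutive boxes starting in column $i$). A standard Young tableau of this shape is a bijective labeling of its $nk$ boxes by $\{1,\dots,nk\}$ such that labels increase from left to right along each row and from top to bottom along each column. -}

module Defs where

open import Data.Nat using (ℕ; _+_; _*_; _≤_; _<_)
open import Data.Fin using (Fin; toℕ)
open import Data.Vec using (Vec; lookup)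
open import Data.Product using (_×_; Σ; ∃₂)
open import Relation.Binary.PropositionalEquality using (_≡_)

-- Row i (0-indexed, i : Fin n) consists of the k boxes in columns i, i+1, ..., i+k-1
-- (0-indexed; i.e. columns i+1 .. i+k in the paper's 1-indexed convention).
-- We store row i as a vector of length k; entry j (j : Fin k) is the label of
-- the box in row i, column i + j.
Filling : ℕ → ℕ → Set
Filling n k = Vec (Vec ℕ k) n

lab : ∀ {n k} → Filling n k → Fin n → Fin k → ℕ
lab T i j = lookup (lookup T i) j

col : ∀ {n k} → Fin n → Fin k → ℕ
col i j = toℕ i + toℕ j

record IsSYT {n k : ℕ} (T : Filling n k) : Set where
  field
    inRange    : ∀ i j → 1 ≤ lab T i j × lab T i j ≤ n * k
    injective  : ∀ i j i′ j′ → lab T i j ≡ lab T i′ j′ → (i ≡ i′ × j ≡ j′)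
    surjective : ∀ m → 1 ≤ m → m ≤ n * k → ∃₂ λ i j → lab T i j ≡ m
    rowIncr    : ∀ i j j′ → toℕ j < toℕ j′ → lab T i j < lab T i j′
    colIncr    : ∀ i j i′ j′ → toℕ i < toℕ i′ → col i j ≡ col i′ j′
                 → lab T i j < lab T i′ j′

module Submission where

open import Data.Nat using (ℕ; _≤_; _∸_)
open import Data.Integer using (ℤ; +_; _-_) renaming (_*_ to _*ℤ_)
open import Data.List using (List; length)
open import Data.List.Membership.Propositional using (_∈_)
open import Data.List.Relation.Unary.Unique.Propositional using (Unique)
open import Data.Product using (Σ; _×_)
open import Relation.Binary.PropositionalEquality using (_≡_)
open import Defs

-- Insert the labels 1, 2, 3, … in increasing order.  At any moment
-- the filled boxes are f complete rows followed by a window of at most four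
-- partially filled rows (a row can only be filled up to two boxes behind
-- the row above it).  Counting the continuations from a window gives a
-- recursion `count` over the number of remaining rows.  Each time the top
-- row of the window is completed the window slides down one row and is then
-- one of eight arrival windows, so these counts evolve by an 8×8 transfer
-- matrix; an identity between its first powers yields the recurrence.

open import Data.Nat using (zero; suc; _+_; _*_; _<_; z≤n; s≤s; s≤s⁻¹; _≡ᵇ_)
open import Data.Nat.Properties
  using ( _≟_; _≤?_; _<?_; +-assoc; +-comm; +-suc; +-identityʳ; *-zeroʳ; *-assoc; *-comm; *-distribˡ-+
        ; +-cancelˡ-≡; +-cancelʳ-≡; +-cancelˡ-<; +-mono-≤; +-monoˡ-≤; +-monoʳ-≤; +-monoʳ-<; +-mono-<-≤
        ; ≤-refl; ≤-reflexive; ≤-trans; <-trans; <-≤-trans; <-irrefl; <-cmp; <⇒≤; <⇒≢; <⇒≱; ≮⇒≥; ≰⇒>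
        ; ≤∧≢⇒<; m≤n⇒m<n∨m≡n; m≤n⇒m≤1+n; n≤1+n; n≮0; m≤m+n; m+[n∸m]≡n; suc-injective; ≡ᵇ⇒≡ )
open import Data.Nat.ListAction using (sum)
open import Data.Nat.ListAction.Properties using (sum-++)
open import Data.Nat.Tactic.RingSolver using (solve-∀)
open import Data.Integer using () renaming (_+_ to _+ℤ_)
import Data.Integer.Properties as ℤ
open import Data.Integer.Tactic.RingSolver using () renaming (solve-∀ to solveℤ-∀)
open import Data.Fin using (Fin; zero; suc; toℕ; fromℕ; fromℕ<)
open import Data.Fin.Properties using (toℕ-fromℕ<; toℕ-injective; toℕ<n)
open import Data.Vec using (Vec; []; _∷_; _∷ʳ_; lookup; replicate; updateAt; zipWith)
import Data.Vec as Vec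
open import Data.Vec.Relation.Binary.Pointwise.Extensional using (ext; Pointwise-≡⇒≡)
open import Data.List using ([]; _∷_; _++_; map; filter; allFin; concatMap)
open import Data.List.Properties using (map-++; map-cong; map-∘; length-++)
open import Data.List.Membership.Propositional using (find; lose)
open import Data.List.Membership.Propositional.Properties
  using (∈-concatMap⁺; ∈-concatMap⁻; ∈-filter⁺; ∈-filter⁻; ∈-allFin)
open import Data.List.Relation.Unary.Any using (here; there)
import Data.List.Relation.Unary.All as All
import Data.List.Relation.Unary.AllPairs as AllPairs
import Data.List.Relation.Unary.Unique.Propositional.Properties as UniqueProps
open import Data.Bool using (Bool; true; false; T)
open import Data.Unit using (⊤; tt)
open import Data.Empty using (⊥; ⊥-elim)
open import Data.Product using (∃₂; _,_; proj₁; proj₂)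
open import Data.Sum using (_⊎_; inj₁; inj₂)
open import Function using (_∘_; flip)
open import Relation.Nullary using (¬_; Dec; yes; no)
open import Relation.Nullary.Decidable using (_×-dec_)
open import Relation.Binary using (tri<; tri≈; tri>)
open import Relation.Binary.PropositionalEquality using (_≢_; refl; sym; trans; cong; cong₂; subst; subst₂; module ≡-Reasoning)

open ≡-Reasoning

+-trade : ∀ {x y b c} → x < b → x + y ≡ b + c → c < y
+-trade {x} {y} {b} {c} x<b same with c <? y
... | yes c<y = c<y
... | no c≮y = ⊥-elim (<-irrefl same (+-mono-<-≤ x<b (≮⇒≥ c≮y)))

gap⇒< : ∀ {x y} → x + 2 ≤ y → suc x < y
gap⇒< {x} gap = ≤-trans (≤-reflexive (+-comm 2 x)) gap

length-concatMap : ∀ {A B : Set} (F : A → List B) xs → length (concatMap F xs) ≡ sum (map (length ∘ F) xs)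
length-concatMap F [] = refl
length-concatMap F (x ∷ xs) = trans (length-++ (F x)) (cong (_+_ (length (F x))) (length-concatMap F xs))

sum-map-concatMap : ∀ {A B : Set} (φ : B → ℕ) (F : A → List B) (xs : List A) →
  sum (map φ (concatMap F xs)) ≡ sum (map (λ x → sum (map φ (F x))) xs)
sum-map-concatMap φ F [] = refl
sum-map-concatMap φ F (x ∷ xs) = begin
    sum (map φ (F x ++ concatMap F xs))
  ≡⟨ cong sum (map-++ φ (F x) (concatMap F xs)) ⟩
    sum (map φ (F x) ++ map φ (concatMap F xs))
  ≡⟨ sum-++ (map φ (F x)) _ ⟩
    sum (map φ (F x)) + sum (map φ (concatMap F xs))
  ≡⟨ cong (λ s → sum (map φ (F x)) + s) (sum-map-concatMap φ F xs) ⟩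
    sum (map φ (F x)) + sum (map (λ x → sum (map φ (F x))) xs)
  ∎

unique-concatMap : ∀ {A B : Set} (F : A → List B) (xs : List A) → Unique xs →
  (∀ x → x ∈ xs → Unique (F x)) →
  (∀ x x′ → x ∈ xs → x′ ∈ xs → ∀ y → y ∈ F x → y ∈ F x′ → x ≡ x′) →
  Unique (concatMap F xs)
unique-concatMap F [] _ _ _ = AllPairs.[]
unique-concatMap F (x ∷ xs) (x∉xs AllPairs.∷ unique-xs) unique-F disjoint =
  UniqueProps.++⁺ (unique-F x (here refl))
    (unique-concatMap F xs unique-xs (λ x′ x′∈ → unique-F x′ (there x′∈))
                      (λ x′ x″ x′∈ x″∈ → disjoint x′ x″ (there x′∈) (there x″∈)))
    (λ (y∈Fx , y∈rest) → apart y∈Fx y∈rest)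
  where
  apart : ∀ {y} → y ∈ F x → y ∈ concatMap F xs → ⊥
  apart y∈Fx y∈rest with find (∈-concatMap⁻ F {xs = xs} y∈rest)
  ... | x′ , x′∈ , y∈Fx′ = All.lookup x∉xs x′∈ (disjoint x x′ (here refl) (there x′∈) _ y∈Fx y∈Fx′)

-- Update the entry at position x of a vector, given as a number (a no-op
-- when x is out of range, so that the enumeration needs no bound proofs).
updateAtℕ : ∀ {A : Set} {k} → ℕ → (A → A) → Vec A k → Vec A k
updateAtℕ x f [] = []
updateAtℕ zero f (a ∷ as) = f a ∷ as
updateAtℕ (suc x) f (a ∷ as) = a ∷ updateAtℕ x f as

lookup-updateAtℕ-here : ∀ {A : Set} {k} (f : A → A) (as : Vec A k) i → lookup (updateAtℕ (toℕ i) f as) i ≡ f (lookup as i)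
lookup-updateAtℕ-here f (a ∷ as) zero = refl
lookup-updateAtℕ-here f (a ∷ as) (suc i) = lookup-updateAtℕ-here f as i

lookup-updateAtℕ-elsewhere : ∀ {A : Set} {k} x (f : A → A) (as : Vec A k) i → toℕ i ≢ x →
  lookup (updateAtℕ x f as) i ≡ lookup as i
lookup-updateAtℕ-elsewhere zero f (a ∷ as) zero i≢x = ⊥-elim (i≢x refl)
lookup-updateAtℕ-elsewhere (suc x) f (a ∷ as) zero _ = refl
lookup-updateAtℕ-elsewhere zero f (a ∷ as) (suc i) _ = refl
lookup-updateAtℕ-elsewhere (suc x) f (a ∷ as) (suc i) i≢x = lookup-updateAtℕ-elsewhere x f as i (i≢x ∘ cong suc)

write : ∀ {n k} → ℕ → ℕ → ℕ → Filling n k → Filling n k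
write x y v P = updateAtℕ x (updateAtℕ y (λ _ → v)) P

lab-write-here : ∀ {n k} x y v (P : Filling n k) i j → toℕ i ≡ x → toℕ j ≡ y → lab (write x y v P) i j ≡ v
lab-write-here x y v P i j refl refl =
  trans (cong (λ row → lookup row j) (lookup-updateAtℕ-here _ P i)) (lookup-updateAtℕ-here _ (lookup P i) j)

lab-write-elsewhere : ∀ {n k} x y v (P : Filling n k) i j → ¬ (toℕ i ≡ x × toℕ j ≡ y) →
  lab (write x y v P) i j ≡ lab P i j
lab-write-elsewhere x y v P i j ¬here with toℕ i ≟ x
... | no i≢x = cong (λ row → lookup row j) (lookup-updateAtℕ-elsewhere x _ P i i≢x)
... | yes refl = trans (cong (λ row → lookup row j) (lookup-updateAtℕ-here _ P i))
                       (lookup-updateAtℕ-elsewhere y _ (lookup P i) j (λ j≡y → ¬here (refl , j≡y)))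

filling-ext : ∀ {n k} (P T : Filling n k) → (∀ i j → lab P i j ≡ lab T i j) → P ≡ T
filling-ext P T same = Pointwise-≡⇒≡ (ext λ i → Pointwise-≡⇒≡ (ext (same i)))

-- Linear forms on ℕ-valued functions on Fin k, given by coefficient vectors.

infixl 6 _+ᵥ_
infixl 7 _·ᵥ_

_+ᵥ_ : ∀ {k} → Vec ℕ k → Vec ℕ k → Vec ℕ k
_+ᵥ_ = zipWith _+_

_·ᵥ_ : ∀ {k} → ℕ → Vec ℕ k → Vec ℕ k
c ·ᵥ v = Vec.map (c *_) v

dot : ∀ {k} → Vec ℕ k → (Fin k → ℕ) → ℕ
dot [] ψ = 0
dot (c ∷ cs) ψ = c * ψ zero + dot cs (ψ ∘ suc)

tally : ∀ {k} → List (Fin k) → Vec ℕ k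
tally [] = replicate _ 0
tally (x ∷ xs) = updateAt (tally xs) x suc

combine : ∀ {m k} → Vec ℕ m → (Fin m → Vec ℕ k) → Vec ℕ k
combine [] M = replicate _ 0
combine (c ∷ cs) M = c ·ᵥ M zero +ᵥ combine cs (M ∘ suc)

dot-zero : ∀ {k} (ψ : Fin k → ℕ) → dot (replicate k 0) ψ ≡ 0
dot-zero {zero} ψ = refl
dot-zero {suc k} ψ = dot-zero (ψ ∘ suc)

dot-cong : ∀ {k} (c : Vec ℕ k) {ψ ψ′ : Fin k → ℕ} → (∀ i → ψ i ≡ ψ′ i) → dot c ψ ≡ dot c ψ′
dot-cong [] e = refl
dot-cong (c ∷ cs) e = cong₂ _+_ (cong (c *_) (e zero)) (dot-cong cs (e ∘ suc))

dot-increment : ∀ {k} (x : Fin k) c ψ → dot (updateAt c x suc) ψ ≡ ψ x + dot c ψ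
dot-increment zero (c ∷ cs) ψ = +-assoc (ψ zero) (c * ψ zero) _
dot-increment (suc x) (c ∷ cs) ψ =
  trans (cong (_+_ (c * ψ zero)) (dot-increment x cs (ψ ∘ suc))) (exchange (c * ψ zero) (ψ (suc x)) (dot cs (ψ ∘ suc)))
  where
  exchange : ∀ x y z → x + (y + z) ≡ y + (x + z)
  exchange = solve-∀

sum≡dot-tally : ∀ {k} (ψ : Fin k → ℕ) xs → sum (map ψ xs) ≡ dot (tally xs) ψ
sum≡dot-tally ψ [] = sym (dot-zero ψ)
sum≡dot-tally ψ (x ∷ xs) = trans (cong (_+_ (ψ x)) (sum≡dot-tally ψ xs)) (sym (dot-increment x (tally xs) ψ))

dot-+ : ∀ {k} (a b : Vec ℕ k) ψ → dot (a +ᵥ b) ψ ≡ dot a ψ + dot b ψ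
dot-+ [] [] ψ = refl
dot-+ (a ∷ as) (b ∷ bs) ψ =
  trans (cong (_+_ ((a + b) * ψ zero)) (dot-+ as bs (ψ ∘ suc))) (distribute a b (ψ zero) _ _)
  where
  distribute : ∀ a b p s t → (a + b) * p + (s + t) ≡ (a * p + s) + (b * p + t)
  distribute = solve-∀

dot-· : ∀ {k} c (a : Vec ℕ k) ψ → dot (c ·ᵥ a) ψ ≡ c * dot a ψ
dot-· c [] ψ = sym (*-zeroʳ c)
dot-· c (a ∷ as) ψ =
  trans (cong₂ _+_ (*-assoc c a (ψ zero)) (dot-· c as (ψ ∘ suc))) (sym (*-distribˡ-+ c (a * ψ zero) _))

dot-combine : ∀ {m k} (c : Vec ℕ m) (M : Fin m → Vec ℕ k) ψ →
  dot c (λ i → dot (M i) ψ) ≡ dot (combine c M) ψ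
dot-combine [] M ψ = sym (dot-zero ψ)
dot-combine (c ∷ cs) M ψ = begin
    c * dot (M zero) ψ + dot cs (λ i → dot (M (suc i)) ψ)
  ≡⟨ cong₂ _+_ (sym (dot-· c (M zero) ψ)) (dot-combine cs (M ∘ suc) ψ) ⟩
    dot (c ·ᵥ M zero) ψ + dot (combine cs (M ∘ suc)) ψ
  ≡⟨ sym (dot-+ (c ·ᵥ M zero) _ ψ) ⟩
    dot (combine (c ∷ cs) M) ψ
  ∎

dot-·+· : ∀ {k} a (u : Vec ℕ k) b v ψ → dot (a ·ᵥ u +ᵥ b ·ᵥ v) ψ ≡ a * dot u ψ + b * dot v ψ
dot-·+· a u b v ψ = trans (dot-+ (a ·ᵥ u) (b ·ᵥ v) ψ) (cong₂ _+_ (dot-· a u ψ) (dot-· b v ψ))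

-- While labels 1, 2, 3, … are inserted in increasing
-- order, the filled boxes always form a "profile": the first f rows are
-- complete, and the next rows hold q₀ ≥ q₁ ≥ … boxes.  Since a box in row
-- i+1 sits below the box one column to its right in row i, only four rows
-- can be partially filled at once; we record their lengths.
Window : Set
Window = Vec ℕ 4

rowLength : ∀ {k} → Vec ℕ k → ℕ → ℕ
rowLength [] y = 0
rowLength (a ∷ q) zero = a
rowLength (a ∷ q) (suc y) = rowLength q y

-- The next box of row t of the window has its upper neighbour filled:
-- trivially for t = 0 (the row above is complete), and q_t + 2 ≤ q_{t-1}
-- otherwise.
Supported : Window → Fin 4 → Set
Supported q zero = ⊤
Supported q (suc t) = rowLength q (suc (toℕ t)) + 2 ≤ rowLength q (toℕ t)

supported? : ∀ q t → Dec (Supported q t)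
supported? q zero = yes tt
supported? q (suc t) = rowLength q (suc (toℕ t)) + 2 ≤? rowLength q (toℕ t)

-- Row t of the window may receive the next label when it exists (only R
-- rows of the shape remain from the top of the window on) and is supported.
Addable : ℕ → Window → Fin 4 → Set
Addable R q t = toℕ t < R × Supported q t

addable? : ∀ R q t → Dec (Addable R q t)
addable? R q t = (toℕ t <? R) ×-dec supported? q t

addableRows : ℕ → Window → List (Fin 4)
addableRows R q = filter (addable? R q) (allFin 4)

grow : Window → Fin 4 → Window
grow q t = updateAt q t suc

completes : Fin 4 → Window → Bool
completes zero (a ∷ _) = a ≡ᵇ 4
completes (suc t) q = false

slide : Window → Window
slide (a ∷ q) = q ∷ʳ 0

emptyWindow : Window
emptyWindow = 0 ∷ 0 ∷ 0 ∷ 0 ∷ []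

-- Number of ways to insert further labels into the window q, at most k of
-- them, until the top row is completed; each way is weighted by φ of the
-- window after sliding.  (Eleven steps suffice: see complete-untilSlide.)
mutual
  countUntilSlide : (Window → ℕ) → ℕ → ℕ → Window → ℕ
  countUntilSlide φ R zero q = 0
  countUntilSlide φ R (suc k) q = sum (map (λ t → countBranch φ R k q t (completes t q)) (addableRows R q))

  countBranch : (Window → ℕ) → ℕ → ℕ → Window → Fin 4 → Bool → ℕ
  countBranch φ R k q t true = φ (slide (grow q t))
  countBranch φ R k q t false = countUntilSlide φ R k (grow q t)

-- count r q: number of ways to fill the last r rows of the shape, given
-- the window q on top of them (and everything above complete).
count : ℕ → Window → ℕ
count zero q = 1
count (suc r) q = countUntilSlide (count r) (suc r) 11 q

mutual
  slides : ℕ → ℕ → Window → List Window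
  slides R zero q = []
  slides R (suc k) q = concatMap (λ t → slidesBranch R k q t (completes t q)) (addableRows R q)

  slidesBranch : ℕ → ℕ → Window → Fin 4 → Bool → List Window
  slidesBranch R k q t true = slide (grow q t) ∷ []
  slidesBranch R k q t false = slides R k (grow q t)

mutual
  countUntilSlide-slides : ∀ φ R k q → countUntilSlide φ R k q ≡ sum (map φ (slides R k q))
  countUntilSlide-slides φ R zero q = refl
  countUntilSlide-slides φ R (suc k) q =
    trans (cong sum (map-cong (λ t → countBranch-slides φ R k q t (completes t q)) (addableRows R q)))
          (sym (sum-map-concatMap φ (λ t → slidesBranch R k q t (completes t q)) (addableRows R q)))

  countBranch-slides : ∀ φ R k q t b → countBranch φ R k q t b ≡ sum (map φ (slidesBranch R k q t b))
  countBranch-slides φ R k q t true = sym (+-identityʳ _)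
  countBranch-slides φ R k q t false = countUntilSlide-slides φ R k (grow q t)

-- The eight windows in which a slide can end, starting from the empty
-- window; `arrivalIndex` numbers them (and sends other windows to 0).
arrival : Fin 8 → Window
arrival zero = 0 ∷ 0 ∷ 0 ∷ 0 ∷ []
arrival (suc zero) = 1 ∷ 0 ∷ 0 ∷ 0 ∷ []
arrival (suc (suc zero)) = 2 ∷ 0 ∷ 0 ∷ 0 ∷ []
arrival (suc (suc (suc zero))) = 2 ∷ 1 ∷ 0 ∷ 0 ∷ []
arrival (suc (suc (suc (suc zero)))) = 3 ∷ 0 ∷ 0 ∷ 0 ∷ []
arrival (suc (suc (suc (suc (suc zero))))) = 3 ∷ 1 ∷ 0 ∷ 0 ∷ []
arrival (suc (suc (suc (suc (suc (suc zero)))))) = 3 ∷ 2 ∷ 0 ∷ 0 ∷ []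
arrival (suc (suc (suc (suc (suc (suc (suc zero))))))) = 3 ∷ 2 ∷ 1 ∷ 0 ∷ []

arrivalIndex : Window → Fin 8
arrivalIndex (1 ∷ 0 ∷ 0 ∷ 0 ∷ []) = suc zero
arrivalIndex (2 ∷ 0 ∷ 0 ∷ 0 ∷ []) = suc (suc zero)
arrivalIndex (2 ∷ 1 ∷ 0 ∷ 0 ∷ []) = suc (suc (suc zero))
arrivalIndex (3 ∷ 0 ∷ 0 ∷ 0 ∷ []) = suc (suc (suc (suc zero)))
arrivalIndex (3 ∷ 1 ∷ 0 ∷ 0 ∷ []) = suc (suc (suc (suc (suc zero))))
arrivalIndex (3 ∷ 2 ∷ 0 ∷ 0 ∷ []) = suc (suc (suc (suc (suc (suc zero)))))
arrivalIndex (3 ∷ 2 ∷ 1 ∷ 0 ∷ []) = suc (suc (suc (suc (suc (suc (suc zero))))))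
arrivalIndex _ = zero

-- Row s of the transfer matrix: how often each arrival window is reached
-- by the next slide from arrival window s.
transfer : Fin 8 → Vec ℕ 8
transfer s = tally (map arrivalIndex (slides 4 11 (arrival s)))

-- Slides starting at an arrival window end at arrival windows, and once at
-- least four rows remain the slide tree does not depend on their number.
slides-arrivals : ∀ r s → map (arrival ∘ arrivalIndex) (slides 4 11 (arrival s)) ≡ slides (4 + r) 11 (arrival s)
slides-arrivals r zero = refl
slides-arrivals r (suc zero) = refl
slides-arrivals r (suc (suc zero)) = refl
slides-arrivals r (suc (suc (suc zero))) = refl
slides-arrivals r (suc (suc (suc (suc zero)))) = refl
slides-arrivals r (suc (suc (suc (suc (suc zero))))) = refl
slides-arrivals r (suc (suc (suc (suc (suc (suc zero)))))) = refl
slides-arrivals r (suc (suc (suc (suc (suc (suc (suc zero))))))) = refl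

-- count at the arrival windows.  It is opaque so that the symbolic
-- identities below are never checked by unfolding the enumeration.
opaque
  arrivalCount : ℕ → Fin 8 → ℕ
  arrivalCount r s = count r (arrival s)

  arrivalCount-unfold : ∀ r s → arrivalCount r s ≡ count r (arrival s)
  arrivalCount-unfold r s = refl

count-step : ∀ r s → arrivalCount (4 + r) s ≡ dot (transfer s) (arrivalCount (3 + r))
count-step r s = begin
    arrivalCount (4 + r) s
  ≡⟨ arrivalCount-unfold (4 + r) s ⟩
    count (4 + r) (arrival s)
  ≡⟨ countUntilSlide-slides (count (3 + r)) (4 + r) 11 (arrival s) ⟩
    sum (map (count (3 + r)) (slides (4 + r) 11 (arrival s)))
  ≡⟨ cong (λ l → sum (map (count (3 + r)) l)) (sym (slides-arrivals r s)) ⟩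
    sum (map (count (3 + r)) (map (arrival ∘ arrivalIndex) nexts))
  ≡⟨ cong sum (sym (map-∘ nexts)) ⟩
    sum (map (count (3 + r) ∘ arrival ∘ arrivalIndex) nexts)
  ≡⟨ cong sum (map-cong (λ w → sym (arrivalCount-unfold (3 + r) (arrivalIndex w))) nexts) ⟩
    sum (map (arrivalCount (3 + r) ∘ arrivalIndex) nexts)
  ≡⟨ cong sum (map-∘ nexts) ⟩
    sum (map (arrivalCount (3 + r)) (map arrivalIndex nexts))
  ≡⟨ sum≡dot-tally (arrivalCount (3 + r)) (map arrivalIndex nexts) ⟩
    dot (transfer s) (arrivalCount (3 + r))
  ∎
  where
  nexts : List Window
  nexts = slides 4 11 (arrival s)

e₀ e₁ : Vec ℕ 8
e₀ = 1 ∷ 0 ∷ 0 ∷ 0 ∷ 0 ∷ 0 ∷ 0 ∷ 0 ∷ []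
e₁ = 0 ∷ 1 ∷ 0 ∷ 0 ∷ 0 ∷ 0 ∷ 0 ∷ 0 ∷ []

dot-e₀ : ∀ ψ → dot e₀ ψ ≡ ψ zero
dot-e₀ ψ = trans (+-identityʳ _) (+-identityʳ _)

dot-e₁ : ∀ ψ → dot e₁ ψ ≡ ψ (suc zero)
dot-e₁ ψ = trans (+-identityʳ _) (+-identityʳ _)

orbit : ℕ → Vec ℕ 8
orbit zero = e₀
orbit (suc k) = combine (orbit k) transfer

count-orbit : ∀ k r → arrivalCount (k + (3 + r)) zero ≡ dot (orbit k) (arrivalCount (3 + r))
count-orbit zero r = sym (dot-e₀ (arrivalCount (3 + r)))
count-orbit (suc k) r = begin
    arrivalCount (suc k + (3 + r)) zero
  ≡⟨ cong (λ x → arrivalCount x zero) (sym (+-suc k (3 + r))) ⟩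
    arrivalCount (k + (3 + suc r)) zero
  ≡⟨ count-orbit k (suc r) ⟩
    dot (orbit k) (arrivalCount (4 + r))
  ≡⟨ dot-cong (orbit k) (count-step r) ⟩
    dot (orbit k) (λ s → dot (transfer s) (arrivalCount (3 + r)))
  ≡⟨ dot-combine (orbit k) transfer (arrivalCount (3 + r)) ⟩
    dot (orbit (suc k)) (arrivalCount (3 + r))
  ∎

-- The orbit satisfies the recurrence up to the difference e₁ − e₀, which
-- is invisible to forms with ψ 0 = ψ 1.  (A computation with 8×8 matrices.)
orbit-relation : orbit 3 +ᵥ 40 ·ᵥ orbit 1 +ᵥ (8 ·ᵥ orbit 0 +ᵥ 2 ·ᵥ e₁) ≡ 24 ·ᵥ orbit 2 +ᵥ 2 ·ᵥ e₀
orbit-relation = refl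

relation⇒recurrence : ∀ (w₀ w₁ w₂ w₃ : Vec ℕ 8) →
  w₃ +ᵥ 40 ·ᵥ w₁ +ᵥ (8 ·ᵥ w₀ +ᵥ 2 ·ᵥ e₁) ≡ 24 ·ᵥ w₂ +ᵥ 2 ·ᵥ e₀ →
  ∀ ψ → ψ zero ≡ ψ (suc zero) → dot w₃ ψ + 40 * dot w₁ ψ + 8 * dot w₀ ψ ≡ 24 * dot w₂ ψ
relation⇒recurrence w₀ w₁ w₂ w₃ relation ψ ψ₀≡ψ₁ = +-cancelʳ-≡ (2 * ψ zero) _ _ (begin
    dot w₃ ψ + 40 * dot w₁ ψ + 8 * dot w₀ ψ + 2 * ψ zero
  ≡⟨ +-assoc (dot w₃ ψ + 40 * dot w₁ ψ) (8 * dot w₀ ψ) (2 * ψ zero) ⟩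
    (dot w₃ ψ + 40 * dot w₁ ψ) + (8 * dot w₀ ψ + 2 * ψ zero)
  ≡⟨ cong₂ _+_ (sym left) (cong (λ x → 8 * dot w₀ ψ + 2 * x) (trans ψ₀≡ψ₁ (sym (dot-e₁ ψ)))) ⟩
    dot (w₃ +ᵥ 40 ·ᵥ w₁) ψ + (8 * dot w₀ ψ + 2 * dot e₁ ψ)
  ≡⟨ cong (_+_ (dot (w₃ +ᵥ 40 ·ᵥ w₁) ψ)) (sym (dot-·+· 8 w₀ 2 e₁ ψ)) ⟩
    dot (w₃ +ᵥ 40 ·ᵥ w₁) ψ + dot (8 ·ᵥ w₀ +ᵥ 2 ·ᵥ e₁) ψ
  ≡⟨ sym (dot-+ (w₃ +ᵥ 40 ·ᵥ w₁) (8 ·ᵥ w₀ +ᵥ 2 ·ᵥ e₁) ψ) ⟩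
    dot (w₃ +ᵥ 40 ·ᵥ w₁ +ᵥ (8 ·ᵥ w₀ +ᵥ 2 ·ᵥ e₁)) ψ
  ≡⟨ cong (λ v → dot v ψ) relation ⟩
    dot (24 ·ᵥ w₂ +ᵥ 2 ·ᵥ e₀) ψ
  ≡⟨ dot-·+· 24 w₂ 2 e₀ ψ ⟩
    24 * dot w₂ ψ + 2 * dot e₀ ψ
  ≡⟨ cong (λ x → 24 * dot w₂ ψ + 2 * x) (dot-e₀ ψ) ⟩
    24 * dot w₂ ψ + 2 * ψ zero
  ∎)
  where
  left : dot (w₃ +ᵥ 40 ·ᵥ w₁) ψ ≡ dot w₃ ψ + 40 * dot w₁ ψ
  left = trans (dot-+ w₃ (40 ·ᵥ w₁) ψ) (cong (_+_ (dot w₃ ψ)) (dot-· 40 w₁ ψ))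

-- The empty window and the window (1,0,0,0) lead to the same slides: the
-- first box of the top row is forced.  Hence they have the same counts.
transfer-empty≡single : transfer zero ≡ transfer (suc zero)
transfer-empty≡single = refl

empty≡single : ∀ r → arrivalCount (3 + r) zero ≡ arrivalCount (3 + r) (suc zero)
empty≡single zero = trans (arrivalCount-unfold 3 zero) (sym (arrivalCount-unfold 3 (suc zero)))
empty≡single (suc r) = begin
    arrivalCount (4 + r) zero
  ≡⟨ count-step r zero ⟩
    dot (transfer zero) (arrivalCount (3 + r))
  ≡⟨ cong (λ v → dot v (arrivalCount (3 + r))) transfer-empty≡single ⟩
    dot (transfer (suc zero)) (arrivalCount (3 + r))
  ≡⟨ sym (count-step r (suc zero)) ⟩
    arrivalCount (4 + r) (suc zero)
  ∎

tableauCount : ℕ → ℕ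
tableauCount n = arrivalCount n zero

recurrence-from-6 : ∀ r →
  tableauCount (6 + r) + 40 * tableauCount (4 + r) + 8 * tableauCount (3 + r) ≡ 24 * tableauCount (5 + r)
recurrence-from-6 r = begin
    tableauCount (6 + r) + 40 * tableauCount (4 + r) + 8 * tableauCount (3 + r)
  ≡⟨ cong₂ _+_ (cong₂ (λ x y → x + 40 * y) (count-orbit 3 r) (count-orbit 1 r)) (cong (8 *_) (count-orbit 0 r)) ⟩
    dot (orbit 3) ψ + 40 * dot (orbit 1) ψ + 8 * dot (orbit 0) ψ
  ≡⟨ relation⇒recurrence (orbit 0) (orbit 1) (orbit 2) (orbit 3) orbit-relation ψ (empty≡single r) ⟩
    24 * dot (orbit 2) ψ
  ≡⟨ cong (24 *_) (sym (count-orbit 2 r)) ⟩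
    24 * tableauCount (5 + r)
  ∎
  where
  ψ : Fin 8 → ℕ
  ψ = arrivalCount (3 + r)

count₃ : Fin 8 → ℕ
count₃ zero = 290
count₃ (suc zero) = 290
count₃ (suc (suc zero)) = 290
count₃ (suc (suc (suc zero))) = 110
count₃ (suc (suc (suc (suc zero)))) = 180
count₃ (suc (suc (suc (suc (suc zero))))) = 110
count₃ (suc (suc (suc (suc (suc (suc zero)))))) = 54
count₃ (suc (suc (suc (suc (suc (suc (suc zero))))))) = 12

count₃-correct : ∀ s → arrivalCount 3 s ≡ count₃ s
count₃-correct zero = arrivalCount-unfold 3 _
count₃-correct (suc zero) = arrivalCount-unfold 3 _
count₃-correct (suc (suc zero)) = arrivalCount-unfold 3 _
count₃-correct (suc (suc (suc zero))) = arrivalCount-unfold 3 _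
count₃-correct (suc (suc (suc (suc zero)))) = arrivalCount-unfold 3 _
count₃-correct (suc (suc (suc (suc (suc zero))))) = arrivalCount-unfold 3 _
count₃-correct (suc (suc (suc (suc (suc (suc zero)))))) = arrivalCount-unfold 3 _
count₃-correct (suc (suc (suc (suc (suc (suc (suc zero))))))) = arrivalCount-unfold 3 _

tableauCount-1 : tableauCount 1 ≡ 1
tableauCount-1 = arrivalCount-unfold 1 zero

tableauCount-2 : tableauCount 2 ≡ 14
tableauCount-2 = arrivalCount-unfold 2 zero

tableauCount-3 : tableauCount 3 ≡ 290
tableauCount-3 = count₃-correct zero

tableauCount-4 : tableauCount 4 ≡ 6392
tableauCount-4 = trans (count-orbit 1 0) (dot-cong (orbit 1) count₃-correct)

tableauCount-5 : tableauCount 5 ≡ 141696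
tableauCount-5 = trans (count-orbit 2 0) (dot-cong (orbit 2) count₃-correct)

recurrence-terms : ∀ {x y z x′ y′ z′} → x ≡ x′ → y ≡ y′ → z ≡ z′ →
  x + 40 * y + 8 * z ≡ x′ + 40 * y′ + 8 * z′
recurrence-terms refl refl refl = refl

recurrenceℕ : ∀ n → 4 ≤ n →
  tableauCount n + 40 * tableauCount (n ∸ 2) + 8 * tableauCount (n ∸ 3) ≡ 24 * tableauCount (n ∸ 1)
recurrenceℕ 0 ()
recurrenceℕ 1 (s≤s ())
recurrenceℕ 2 (s≤s (s≤s ()))
recurrenceℕ 3 (s≤s (s≤s (s≤s ())))
recurrenceℕ 4 _ = trans (recurrence-terms tableauCount-4 tableauCount-2 tableauCount-1) (cong (24 *_) (sym tableauCount-3))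
recurrenceℕ 5 _ = trans (recurrence-terms tableauCount-5 tableauCount-3 tableauCount-2) (cong (24 *_) (sym tableauCount-4))
recurrenceℕ (suc (suc (suc (suc (suc (suc r)))))) _ = recurrence-from-6 r

recurrenceℤ : ∀ a b c d → a + 40 * c + 8 * d ≡ 24 * b →
  + a ≡ (+ 24) *ℤ (+ b) - (+ 40) *ℤ (+ c) - (+ 8) *ℤ (+ d)
recurrenceℤ a b c d e = begin
    + a
  ≡⟨ cancel (+ a) ((+ 40) *ℤ (+ c)) ((+ 8) *ℤ (+ d)) ⟩
    + a +ℤ (+ 40) *ℤ (+ c) +ℤ (+ 8) *ℤ (+ d) - (+ 40) *ℤ (+ c) - (+ 8) *ℤ (+ d)
  ≡⟨ cong (λ x → x - (+ 40) *ℤ (+ c) - (+ 8) *ℤ (+ d)) lhs ⟩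
    (+ 24) *ℤ (+ b) - (+ 40) *ℤ (+ c) - (+ 8) *ℤ (+ d)
  ∎
  where
  cancel : ∀ x y z → x ≡ x +ℤ y +ℤ z - y - z
  cancel = solveℤ-∀
  lhs : + a +ℤ (+ 40) *ℤ (+ c) +ℤ (+ 8) *ℤ (+ d) ≡ (+ 24) *ℤ (+ b)
  lhs = begin
      + a +ℤ (+ 40) *ℤ (+ c) +ℤ (+ 8) *ℤ (+ d)
    ≡⟨ cong₂ (λ x y → + a +ℤ x +ℤ y) (sym (ℤ.pos-* 40 c)) (sym (ℤ.pos-* 8 d)) ⟩
      + a +ℤ + (40 * c) +ℤ + (8 * d)
    ≡⟨ cong (_+ℤ + (8 * d)) (sym (ℤ.pos-+ a (40 * c))) ⟩
      + (a + 40 * c) +ℤ + (8 * d)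
    ≡⟨ sym (ℤ.pos-+ (a + 40 * c) (8 * d)) ⟩
      + (a + 40 * c + 8 * d)
    ≡⟨ cong +_ e ⟩
      + (24 * b)
    ≡⟨ ℤ.pos-* 24 b ⟩
      (+ 24) *ℤ (+ b)
    ∎

recurrence : ∀ n → 4 ≤ n →
  + tableauCount n ≡
    (+ 24) *ℤ (+ tableauCount (n ∸ 1)) - (+ 40) *ℤ (+ tableauCount (n ∸ 2)) - (+ 8) *ℤ (+ tableauCount (n ∸ 3))
recurrence n 4≤n =
  recurrenceℤ (tableauCount n) (tableauCount (n ∸ 1)) (tableauCount (n ∸ 2)) (tableauCount (n ∸ 3)) (recurrenceℕ n 4≤n)

profile : ℕ → Window → ℕ → ℕ
profile zero q x = rowLength q x
profile (suc f) q zero = 5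
profile (suc f) q (suc x) = profile f q x

profile-above : ∀ f q x → x < f → profile f q x ≡ 5
profile-above (suc f) q zero _ = refl
profile-above (suc f) q (suc x) (s≤s x<f) = profile-above f q x x<f

profile-window : ∀ f q y → profile f q (f + y) ≡ rowLength q y
profile-window zero q y = refl
profile-window (suc f) q y = profile-window f q y

size : ∀ {k} → Vec ℕ k → ℕ
size [] = 0
size (a ∷ q) = a + size q

WellFormed : Window → Set
WellFormed (a ∷ b ∷ c ∷ d ∷ []) =
  a ≤ 4 × b ≤ 3 × c ≤ 2 × d ≤ 1 × (1 ≤ b → b < a) × (1 ≤ c → c < b) × (1 ≤ d → d < c)

EmptyFrom : ℕ → Window → Set
EmptyFrom R q = ∀ y → R ≤ y → rowLength q y ≡ 0

-- Row a of the profile L may receive the next label: it is not complete,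
-- and the box above-right of its next box, if there is one, is filled.
Growable : (ℕ → ℕ) → ℕ → Set
Growable L a = L a < 5 × (∀ a′ → a ≡ suc a′ → L a ≤ 3 → L a + 2 ≤ L a′)

wellFormed-row<5 : ∀ q y → WellFormed q → rowLength q y < 5
wellFormed-row<5 (a ∷ b ∷ c ∷ d ∷ []) 0 (a≤4 , _) = s≤s a≤4
wellFormed-row<5 (a ∷ b ∷ c ∷ d ∷ []) 1 (_ , b≤3 , _) = s≤s (≤-trans b≤3 (n≤1+n 3))
wellFormed-row<5 (a ∷ b ∷ c ∷ d ∷ []) 2 (_ , _ , c≤2 , _) = s≤s (≤-trans c≤2 (≤-trans (n≤1+n 2) (n≤1+n 3)))
wellFormed-row<5 (a ∷ b ∷ c ∷ d ∷ []) 3 (_ , _ , _ , d≤1 , _) =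
  s≤s (≤-trans d≤1 (≤-trans (n≤1+n 1) (≤-trans (n≤1+n 2) (n≤1+n 3))))
wellFormed-row<5 (a ∷ b ∷ c ∷ d ∷ []) (suc (suc (suc (suc _)))) _ = s≤s z≤n

wellFormed-size : ∀ q → WellFormed q → size q ≤ 10
wellFormed-size (a ∷ b ∷ c ∷ d ∷ []) (a≤4 , b≤3 , c≤2 , d≤1 , _) =
  +-mono-≤ a≤4 (+-mono-≤ b≤3 (+-mono-≤ c≤2 (+-mono-≤ d≤1 z≤n)))

addable⇒growable : ∀ f R q t → WellFormed q → Addable R q t → Growable (profile f q) (f + toℕ t)
addable⇒growable f R q t wf addable =
  subst (_< 5) (sym (profile-window f q (toℕ t))) (wellFormed-row<5 q (toℕ t) wf) , above t addable
  where
  above : ∀ t → Addable R q t → ∀ a′ → f + toℕ t ≡ suc a′ →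
          profile f q (f + toℕ t) ≤ 3 → profile f q (f + toℕ t) + 2 ≤ profile f q a′
  above zero _ a′ e ≤3
    rewrite profile-above f q a′ (subst (a′ <_) (trans (sym e) (+-identityʳ f)) ≤-refl) = +-monoˡ-≤ 2 ≤3
  above (suc t′) (_ , s) a′ e _
    rewrite sym (suc-injective (trans (sym (+-suc f (toℕ t′))) e))
          | profile-window f q (suc (toℕ t′)) | profile-window f q (toℕ t′) = s

-- … and conversely every growable row of the profile inside the shape is an
-- addable row of the window (the rows above the window are complete, and
-- rows past the fourth of the window cannot be growable).
growable⇒addable : ∀ f R q a → WellFormed q → a < f + R → Growable (profile f q) a →
  Σ (Fin 4) λ t → Addable R q t × f + toℕ t ≡ a
growable⇒addable f R q@(qa ∷ qb ∷ qc ∷ qd ∷ []) a wf@(_ , b≤3 , c≤2 , d≤1 , _) a<f+R growable with <-cmp a f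
... | tri< a<f _ _ = ⊥-elim (<-irrefl refl (subst (_< 5) (profile-above f q a a<f) (proj₁ growable)))
... | tri≈ _ a≡f _ = zero , (+-cancelˡ-< f 0 R (subst (_< f + R) (trans a≡f (sym (+-identityʳ f))) a<f+R) , tt) ,
                     trans (+-identityʳ f) (sym a≡f)
... | tri> _ _ f<a = inWindow (a ∸ f) (m+[n∸m]≡n (<⇒≤ f<a))
  where
  supported : ∀ y → Growable (profile f q) (f + suc y) → rowLength q (suc y) ≤ 3 →
    rowLength q (suc y) + 2 ≤ rowLength q y
  supported y (_ , above) ≤3
    with above (f + y) (+-suc f y) (subst (_≤ 3) (sym (profile-window f q (suc y))) ≤3)
  ... | r rewrite profile-window f q (suc y) | profile-window f q y = r
  inWindow : ∀ y → f + y ≡ a → Σ (Fin 4) λ t → Addable R q t × f + toℕ t ≡ a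
  inWindow y e with subst (_< f + R) (sym e) a<f+R | subst (Growable (profile f q)) (sym e) growable
  inWindow 0 e | lt | g = zero , (+-cancelˡ-< f 0 R lt , tt) , e
  inWindow 1 e | lt | g = suc zero , (+-cancelˡ-< f 1 R lt , supported 0 g b≤3) , e
  inWindow 2 e | lt | g = suc (suc zero) , (+-cancelˡ-< f 2 R lt , supported 1 g (≤-trans c≤2 (n≤1+n 2))) , e
  inWindow 3 e | lt | g =
    suc (suc (suc zero)) , (+-cancelˡ-< f 3 R lt , supported 2 g (≤-trans d≤1 (≤-trans (n≤1+n 1) (n≤1+n 2)))) , e
  inWindow (suc (suc (suc (suc z)))) e | lt | g = ⊥-elim (beyond z (supported (3 + z) g z≤n))
    where
    beyond : ∀ z → 2 ≤ rowLength q (3 + z) → ⊥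
    beyond zero le = <-irrefl refl (≤-trans le d≤1)
    beyond (suc z) ()

rowLength-grow-here : ∀ {k} (q : Vec ℕ k) t → rowLength (updateAt q t suc) (toℕ t) ≡ suc (rowLength q (toℕ t))
rowLength-grow-here (a ∷ q) zero = refl
rowLength-grow-here (a ∷ q) (suc t) = rowLength-grow-here q t

rowLength-grow-elsewhere : ∀ {k} (q : Vec ℕ k) t y → y ≢ toℕ t → rowLength (updateAt q t suc) y ≡ rowLength q y
rowLength-grow-elsewhere (a ∷ q) zero zero y≢t = ⊥-elim (y≢t refl)
rowLength-grow-elsewhere (a ∷ q) zero (suc y) _ = refl
rowLength-grow-elsewhere (a ∷ q) (suc t) zero _ = refl
rowLength-grow-elsewhere (a ∷ q) (suc t) (suc y) y≢t = rowLength-grow-elsewhere q t y (y≢t ∘ cong suc)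

rowLength-∷ʳ0 : ∀ {k} (q : Vec ℕ k) y → rowLength (q ∷ʳ 0) y ≡ rowLength q y
rowLength-∷ʳ0 [] zero = refl
rowLength-∷ʳ0 [] (suc y) = refl
rowLength-∷ʳ0 (a ∷ q) zero = refl
rowLength-∷ʳ0 (a ∷ q) (suc y) = rowLength-∷ʳ0 q y

rowLength-slide : ∀ q y → rowLength (slide q) y ≡ rowLength q (suc y)
rowLength-slide (a ∷ q) y = rowLength-∷ʳ0 q y

profile-grow : ∀ f q t →
  profile f (grow q t) (f + toℕ t) ≡ suc (profile f q (f + toℕ t)) ×
  (∀ x → x ≢ f + toℕ t → profile f (grow q t) x ≡ profile f q x)
profile-grow f q t = grown-row , other-rows f
  where
  grown-row : profile f (grow q t) (f + toℕ t) ≡ suc (profile f q (f + toℕ t))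
  grown-row = begin
      profile f (grow q t) (f + toℕ t)
    ≡⟨ profile-window f (grow q t) (toℕ t) ⟩
      rowLength (grow q t) (toℕ t)
    ≡⟨ rowLength-grow-here q t ⟩
      suc (rowLength q (toℕ t))
    ≡⟨ cong suc (sym (profile-window f q (toℕ t))) ⟩
      suc (profile f q (f + toℕ t))
    ∎
  other-rows : ∀ f x → x ≢ f + toℕ t → profile f (grow q t) x ≡ profile f q x
  other-rows zero x x≢t = rowLength-grow-elsewhere q t x x≢t
  other-rows (suc f) zero _ = refl
  other-rows (suc f) (suc x) x≢ = other-rows f x (x≢ ∘ cong suc)

profile-slide : ∀ f q → rowLength q 0 ≡ 4 →
  profile (suc f) (slide (grow q zero)) f ≡ suc (profile f q f) ×
  (∀ x → x ≢ f → profile (suc f) (slide (grow q zero)) x ≡ profile f q x)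
profile-slide f q top≡4 = grown-row , other-rows f
  where
  grown-row : profile (suc f) (slide (grow q zero)) f ≡ suc (profile f q f)
  grown-row = begin
      profile (suc f) (slide (grow q zero)) f
    ≡⟨ profile-above (suc f) _ f ≤-refl ⟩
      5
    ≡⟨ cong suc (sym top≡4) ⟩
      suc (rowLength q 0)
    ≡⟨ cong suc (sym (trans (cong (profile f q) (sym (+-identityʳ f))) (profile-window f q 0))) ⟩
      suc (profile f q f)
    ∎
  other-rows : ∀ f x → x ≢ f → profile (suc f) (slide (grow q zero)) x ≡ profile f q x
  other-rows zero zero x≢0 = ⊥-elim (x≢0 refl)
  other-rows zero (suc x) _ =
    trans (rowLength-slide (grow q zero) x) (rowLength-grow-elsewhere q zero (suc x) λ ())
  other-rows (suc f) zero _ = refl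
  other-rows (suc f) (suc x) x≢ = other-rows f x (x≢ ∘ cong suc)

completes-true : ∀ t q → completes t q ≡ true → t ≡ zero × rowLength q 0 ≡ 4
completes-true zero (a ∷ q) e = refl , ≡ᵇ⇒≡ a 4 (subst T (sym e) tt)
completes-true (suc t) q ()

completes-false : ∀ q → completes zero q ≡ false → rowLength q 0 ≢ 4
completes-false (_ ∷ q) () refl

wellFormed-grow : ∀ q t → WellFormed q → Supported q t → completes t q ≡ false → WellFormed (grow q t)
wellFormed-grow q@(a ∷ b ∷ c ∷ d ∷ []) zero (a≤4 , b≤3 , c≤2 , d≤1 , b<a , c<b , d<c) _ incomplete =
  ≤∧≢⇒< a≤4 (completes-false q incomplete) , b≤3 , c≤2 , d≤1 , m≤n⇒m≤1+n ∘ b<a , c<b , d<c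
wellFormed-grow (a ∷ b ∷ c ∷ d ∷ []) (suc zero) (a≤4 , b≤3 , c≤2 , d≤1 , b<a , c<b , d<c) gap _ =
  a≤4 , s≤s⁻¹ (≤-trans (gap⇒< gap) a≤4) , c≤2 , d≤1 , (λ _ → gap⇒< gap) , m≤n⇒m≤1+n ∘ c<b , d<c
wellFormed-grow (a ∷ b ∷ c ∷ d ∷ []) (suc (suc zero)) (a≤4 , b≤3 , c≤2 , d≤1 , b<a , c<b , d<c) gap _ =
  a≤4 , b≤3 , s≤s⁻¹ (≤-trans (gap⇒< gap) b≤3) , d≤1 , b<a , (λ _ → gap⇒< gap) , m≤n⇒m≤1+n ∘ d<c
wellFormed-grow (a ∷ b ∷ c ∷ d ∷ []) (suc (suc (suc zero))) (a≤4 , b≤3 , c≤2 , d≤1 , b<a , c<b , d<c) gap _ =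
  a≤4 , b≤3 , c≤2 , s≤s⁻¹ (≤-trans (gap⇒< gap) c≤2) , b<a , c<b , (λ _ → gap⇒< gap)

wellFormed-slide : ∀ q → WellFormed q → WellFormed (slide (grow q zero))
wellFormed-slide (a ∷ b ∷ c ∷ d ∷ []) (_ , b≤3 , c≤2 , d≤1 , _ , c<b , d<c) =
  m≤n⇒m≤1+n b≤3 , m≤n⇒m≤1+n c≤2 , m≤n⇒m≤1+n d≤1 , z≤n , c<b , d<c , λ ()

emptyFrom-grow : ∀ R q t → EmptyFrom R q → toℕ t < R → EmptyFrom R (grow q t)
emptyFrom-grow R q t empty t<R y R≤y =
  trans (rowLength-grow-elsewhere q t y (λ y≡t → <⇒≱ t<R (subst (R ≤_) y≡t R≤y))) (empty y R≤y)

emptyFrom-slide : ∀ r q → EmptyFrom (suc r) q → EmptyFrom r (slide q)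
emptyFrom-slide r q empty y r≤y = trans (rowLength-slide q y) (empty (suc y) (s≤s r≤y))

rowLength-replicate : ∀ k y → rowLength (replicate k 0) y ≡ 0
rowLength-replicate zero y = refl
rowLength-replicate (suc k) zero = refl
rowLength-replicate (suc k) (suc y) = rowLength-replicate k y

rowLength-empty : ∀ y → rowLength emptyWindow y ≡ 0
rowLength-empty = rowLength-replicate 4

emptyFrom0-size : ∀ q → EmptyFrom 0 q → size q ≡ 0
emptyFrom0-size (a ∷ b ∷ c ∷ d ∷ []) empty
  rewrite empty 0 z≤n | empty 1 z≤n | empty 2 z≤n | empty 3 z≤n = refl

size-grow : ∀ {k} (q : Vec ℕ k) t → size (updateAt q t suc) ≡ suc (size q)
size-grow (a ∷ q) zero = refl
size-grow (a ∷ q) (suc t) = trans (cong (_+_ a) (size-grow q t)) (+-suc a (size q))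

filled-grow : ∀ f q t m → m ≡ 5 * f + size q → suc m ≡ 5 * f + size (grow q t)
filled-grow f q t m m≡ = begin
    suc m
  ≡⟨ cong suc m≡ ⟩
    suc (5 * f + size q)
  ≡⟨ sym (+-suc (5 * f) (size q)) ⟩
    5 * f + suc (size q)
  ≡⟨ cong (_+_ (5 * f)) (sym (size-grow q t)) ⟩
    5 * f + size (grow q t)
  ∎

filled-slide : ∀ f q m → rowLength q 0 ≡ 4 → m ≡ 5 * f + size q → suc m ≡ 5 * suc f + size (slide (grow q zero))
filled-slide f (.4 ∷ q) m refl m≡ = begin
    suc m
  ≡⟨ cong suc m≡ ⟩
    suc (5 * f + (4 + size q))
  ≡⟨ rearrange f (size q) ⟩
    5 * suc f + size q
  ≡⟨ cong (_+_ (5 * suc f)) (sym (size-∷ʳ0 q)) ⟩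
    5 * suc f + size (q ∷ʳ 0)
  ∎
  where
  rearrange : ∀ f s → suc (5 * f + (4 + s)) ≡ 5 * suc f + s
  rearrange = solve-∀
  size-∷ʳ0 : ∀ {k} (q : Vec ℕ k) → size (q ∷ʳ 0) ≡ size q
  size-∷ʳ0 [] = refl
  size-∷ʳ0 (a ∷ q) = cong (_+_ a) (size-∷ʳ0 q)

module Tableaux (n : ℕ) where

  Filled : (ℕ → ℕ) → Fin n → Fin 5 → Set
  Filled L i j = toℕ j < L (toℕ i)

  record PartialTableau (L : ℕ → ℕ) (P : Filling n 5) (m : ℕ) : Set where
    field
      inRange    : ∀ i j → Filled L i j → 1 ≤ lab P i j × lab P i j ≤ m
      injective  : ∀ i j i′ j′ → Filled L i j → Filled L i′ j′ → lab P i j ≡ lab P i′ j′ → i ≡ i′ × j ≡ j′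
      surjective : ∀ v → 1 ≤ v → v ≤ m → ∃₂ λ i j → Filled L i j × lab P i j ≡ v
      rowIncr    : ∀ i j j′ → Filled L i j′ → toℕ j < toℕ j′ → lab P i j < lab P i j′
      colIncr    : ∀ i j i′ j′ → Filled L i′ j′ → toℕ i < toℕ i′ → col i j ≡ col i′ j′ → lab P i j < lab P i′ j′
      colClosed  : ∀ i j i′ j′ → Filled L i′ j′ → toℕ i < toℕ i′ → col i j ≡ col i′ j′ → Filled L i j

  record Prefix (T : Filling n 5) (L : ℕ → ℕ) (P : Filling n 5) (m : ℕ) : Set where
    field
      agrees        : ∀ i j → Filled L i j → lab P i j ≡ lab T i j
      small⇒filled  : ∀ i j → lab T i j ≤ m → Filled L i j
      filled⇒small  : ∀ i j → Filled L i j → lab T i j ≤ m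

  open Prefix

  Extends : (ℕ → ℕ) → Filling n 5 → Filling n 5 → Set
  Extends L P X = IsSYT X × (∀ i j → Filled L i j → lab X i j ≡ lab P i j)

  module AddBox (L L′ : ℕ → ℕ) (P : Filling n 5) (m a : ℕ) (a<n : a < n) (growable : Growable L a)
                (grown : L′ a ≡ suc (L a)) (unchanged : ∀ x → x ≢ a → L′ x ≡ L x) where

    i₀ : Fin n
    i₀ = fromℕ< a<n

    j₀ : Fin 5
    j₀ = fromℕ< (proj₁ growable)

    P′ : Filling n 5
    P′ = write a (L a) (suc m) P

    New : Fin n → Fin 5 → Set
    New i j = toℕ i ≡ a × toℕ j ≡ L a

    new₀ : New i₀ j₀
    new₀ = toℕ-fromℕ< a<n , toℕ-fromℕ< (proj₁ growable)

    new-unique : ∀ {i j} → New i j → i ≡ i₀ × j ≡ j₀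
    new-unique (i≡a , j≡La) =
      toℕ-injective (trans i≡a (sym (proj₁ new₀))) , toℕ-injective (trans j≡La (sym (proj₂ new₀)))

    filled′⇒ : ∀ i j → Filled L′ i j → Filled L i j ⊎ New i j
    filled′⇒ i j filled′ with toℕ i ≟ a
    ... | no i≢a = inj₁ (subst (toℕ j <_) (unchanged (toℕ i) i≢a) filled′)
    ... | yes i≡a with m≤n⇒m<n∨m≡n (s≤s⁻¹ (subst (toℕ j <_) (trans (cong L′ i≡a) grown) filled′))
    ...   | inj₁ j<La = inj₁ (subst (λ x → toℕ j < L x) (sym i≡a) j<La)
    ...   | inj₂ j≡La = inj₂ (i≡a , j≡La)

    filled⇒filled′ : ∀ i j → Filled L i j → Filled L′ i j
    filled⇒filled′ i j filled with toℕ i ≟ a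
    ... | no i≢a = subst (toℕ j <_) (sym (unchanged (toℕ i) i≢a)) filled
    ... | yes i≡a = subst (toℕ j <_) (sym (trans (cong L′ i≡a) grown)) (m≤n⇒m≤1+n (subst (λ x → toℕ j < L x) i≡a filled))

    new⇒filled′ : ∀ i j → New i j → Filled L′ i j
    new⇒filled′ i j (i≡a , j≡La) =
      subst (_< L′ (toℕ i)) (sym j≡La) (subst (L a <_) (sym (trans (cong L′ i≡a) grown)) ≤-refl)

    new⇒unfilled : ∀ i j → New i j → ¬ Filled L i j
    new⇒unfilled i j (i≡a , j≡La) filled = <-irrefl j≡La (subst (λ x → toℕ j < L x) i≡a filled)

    lab-old : ∀ i j → Filled L i j → lab P′ i j ≡ lab P i j
    lab-old i j filled = lab-write-elsewhere a (L a) (suc m) P i j (λ new → new⇒unfilled i j new filled)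

    lab-new : ∀ i j → New i j → lab P′ i j ≡ suc m
    lab-new i j (i≡a , j≡La) = lab-write-here a (L a) (suc m) P i j i≡a j≡La

    extends-via-new : ∀ X → Extends L′ P′ X →
      Extends L P X × Σ (Fin n) λ i → Σ (Fin 5) λ j → toℕ i ≡ a × lab X i j ≡ suc m
    extends-via-new X (syt , agree) =
      (syt , λ i j filled → trans (agree i j (filled⇒filled′ i j filled)) (lab-old i j filled)) ,
      i₀ , j₀ , proj₁ new₀ , trans (agree i₀ j₀ (new⇒filled′ i₀ j₀ new₀)) (lab-new i₀ j₀ new₀)

    open PartialTableau

    module _ (C : PartialTableau L P m) where

      old<new : ∀ {i j i′ j′} → Filled L i j → New i′ j′ → lab P′ i j < lab P′ i′ j′
      old<new {i} {j} {i′} {j′} filled new =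
        subst₂ _<_ (sym (lab-old i j filled)) (sym (lab-new i′ j′ new)) (s≤s (proj₂ (inRange C i j filled)))

      -- Every box strictly above the new box in its column is filled: the
      -- one just above by growability of row a, those further up by column
      -- closure.
      above-new-filled : ∀ i j → toℕ i < a → toℕ i + toℕ j ≡ a + L a → Filled L i j
      above-new-filled i j i<a same-col = from-row-above a refl
        where
        La≤3 : L a ≤ 3
        La≤3 = s≤s⁻¹ (<-≤-trans (+-trade i<a same-col) (s≤s⁻¹ (toℕ<n j)))
        from-row-above : ∀ b → b ≡ a → Filled L i j
        from-row-above zero 0≡a = ⊥-elim (n≮0 (subst (toℕ i <_) (sym 0≡a) i<a))
        from-row-above (suc a′) a′+1≡a = in-column (toℕ i ≟ a′)
          where
          gap : L a + 2 ≤ L a′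
          gap = proj₂ growable a′ (sym a′+1≡a) La≤3
          a′<n : a′ < n
          a′<n = <-trans (subst (a′ <_) a′+1≡a ≤-refl) a<n
          c<5 : suc (L a) < 5
          c<5 = s≤s (s≤s La≤3)
          b : Fin n
          b = fromℕ< a′<n
          c : Fin 5
          c = fromℕ< c<5
          filled-bc : Filled L b c
          filled-bc = subst₂ (λ x y → x < L y) (sym (toℕ-fromℕ< c<5)) (sym (toℕ-fromℕ< a′<n)) (gap⇒< gap)
          same-col′ : toℕ i + toℕ j ≡ a′ + suc (L a)
          same-col′ = trans same-col (trans (cong (_+ L a) (sym a′+1≡a)) (sym (+-suc a′ (L a))))
          in-column : Dec (toℕ i ≡ a′) → Filled L i j
          in-column (yes i≡a′) = subst (λ x → toℕ j < L x) (sym i≡a′) (subst (_< L a′) j≡ (gap⇒< gap))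
            where
            j≡ : suc (L a) ≡ toℕ j
            j≡ = +-cancelˡ-≡ a′ (suc (L a)) (toℕ j) (trans (sym same-col′) (cong (_+ toℕ j) i≡a′))
          in-column (no i≢a′) =
            colClosed C i j b c filled-bc i<b (trans same-col′ (sym (cong₂ _+_ (toℕ-fromℕ< a′<n) (toℕ-fromℕ< c<5))))
            where
            i<b : toℕ i < toℕ b
            i<b = subst (toℕ i <_) (sym (toℕ-fromℕ< a′<n))
                    (≤∧≢⇒< (s≤s⁻¹ (subst (toℕ i <_) (sym a′+1≡a) i<a)) i≢a′)

      extend : PartialTableau L′ P′ (suc m)
      inRange extend i j filled′ with filled′⇒ i j filled′
      ... | inj₁ filled = subst (λ v → 1 ≤ v × v ≤ suc m) (sym (lab-old i j filled))
                                (proj₁ (inRange C i j filled) , m≤n⇒m≤1+n (proj₂ (inRange C i j filled)))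
      ... | inj₂ new = subst (λ v → 1 ≤ v × v ≤ suc m) (sym (lab-new i j new)) (s≤s z≤n , ≤-refl)
      injective extend i j i′ j′ f f′ same with filled′⇒ i j f | filled′⇒ i′ j′ f′
      ... | inj₁ p | inj₁ p′ = injective C i j i′ j′ p p′ (trans (sym (lab-old i j p)) (trans same (lab-old i′ j′ p′)))
      ... | inj₁ p | inj₂ new′ = ⊥-elim (<⇒≢ (old<new p new′) same)
      ... | inj₂ new | inj₁ p′ = ⊥-elim (<⇒≢ (old<new p′ new) (sym same))
      ... | inj₂ new | inj₂ new′ with new-unique new | new-unique new′
      ...   | refl , refl | refl , refl = refl , refl
      surjective extend v 1≤v v≤1+m with m≤n⇒m<n∨m≡n v≤1+m
      ... | inj₂ v≡1+m = i₀ , j₀ , new⇒filled′ i₀ j₀ new₀ , trans (lab-new i₀ j₀ new₀) (sym v≡1+m)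
      ... | inj₁ v<1+m with surjective C v 1≤v (s≤s⁻¹ v<1+m)
      ...   | i , j , filled , labv = i , j , filled⇒filled′ i j filled , trans (lab-old i j filled) labv
      rowIncr extend i j j′ filled′ j<j′ with filled′⇒ i j′ filled′
      ... | inj₁ filled = subst₂ _<_ (sym (lab-old i j (<-trans j<j′ filled))) (sym (lab-old i j′ filled))
                                 (rowIncr C i j j′ filled j<j′)
      ... | inj₂ new@(i≡a , j′≡La) = old<new (subst (λ x → toℕ j < L x) (sym i≡a) (subst (toℕ j <_) j′≡La j<j′)) new
      colIncr extend i j i′ j′ filled′ i<i′ same-col with filled′⇒ i′ j′ filled′
      ... | inj₁ filled = subst₂ _<_ (sym (lab-old i j (colClosed C i j i′ j′ filled i<i′ same-col))) (sym (lab-old i′ j′ filled))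
                                 (colIncr C i j i′ j′ filled i<i′ same-col)
      ... | inj₂ new@(i′≡a , j′≡La) =
        old<new (above-new-filled i j (subst (toℕ i <_) i′≡a i<i′) (trans same-col (cong₂ _+_ i′≡a j′≡La))) new
      colClosed extend i j i′ j′ filled′ i<i′ same-col with filled′⇒ i′ j′ filled′
      ... | inj₁ filled = filled⇒filled′ i j (colClosed C i j i′ j′ filled i<i′ same-col)
      ... | inj₂ (i′≡a , j′≡La) =
        filled⇒filled′ i j (above-new-filled i j (subst (toℕ i <_) i′≡a i<i′) (trans same-col (cong₂ _+_ i′≡a j′≡La)))

    extend-prefix : ∀ T → IsSYT T → Prefix T L P m → ∀ i j → New i j → lab T i j ≡ suc m → Prefix T L′ P′ (suc m)
    agrees (extend-prefix T syt pre iₙ jₙ newₙ labₙ) i j filled′ with filled′⇒ i j filled′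
    ... | inj₁ filled = trans (lab-old i j filled) (agrees pre i j filled)
    ... | inj₂ new with new-unique new | new-unique newₙ
    ...   | refl , refl | refl , refl = trans (lab-new i j new) (sym labₙ)
    small⇒filled (extend-prefix T syt pre iₙ jₙ newₙ labₙ) i j ≤1+m with m≤n⇒m<n∨m≡n ≤1+m
    ... | inj₁ <1+m = filled⇒filled′ i j (small⇒filled pre i j (s≤s⁻¹ <1+m))
    ... | inj₂ ≡1+m with IsSYT.injective syt i j iₙ jₙ (trans ≡1+m (sym labₙ))
    ...   | refl , refl = new⇒filled′ i j newₙ
    filled⇒small (extend-prefix T syt pre iₙ jₙ newₙ labₙ) i j filled′ with filled′⇒ i j filled′
    ... | inj₁ filled = m≤n⇒m≤1+n (filled⇒small pre i j filled)
    ... | inj₂ new with new-unique new | new-unique newₙ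
    ...   | refl , refl | refl , refl = ≤-reflexive labₙ

  record NextBox (T : Filling n 5) (L : ℕ → ℕ) (m : ℕ) : Set where
    field
      row      : ℕ
      row<n    : row < n
      growable : Growable L row
      i        : Fin n
      j        : Fin 5
      position : toℕ i ≡ row × toℕ j ≡ L row
      label    : lab T i j ≡ suc m

  -- In a standard Young tableau T whose labels 1 … m fill the profile L, the
  -- label m + 1 (if some box is still empty) ends a growable row: the boxes
  -- left of it and the box above-right of it carry smaller labels.
  next-box : ∀ T L P m → IsSYT T → Prefix T L P m → ∀ i₁ j₁ → ¬ Filled L i₁ j₁ → NextBox T L m
  next-box T L P m syt pre i₁ j₁ unfilled₁ = record
    { row = a ; row<n = toℕ<n i ; growable = subst (_< 5) at-row-end (toℕ<n j) , above-filled
    ; i = i ; j = j ; position = refl , at-row-end ; label = labᵢⱼ }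
    where
    open IsSYT syt using (inRange; surjective; rowIncr; colIncr)
    m<lab₁ : m < lab T i₁ j₁
    m<lab₁ = ≰⇒> (λ ≤m → unfilled₁ (small⇒filled pre i₁ j₁ ≤m))
    found : ∃₂ λ i j → lab T i j ≡ suc m
    found = surjective (suc m) (s≤s z≤n) (≤-trans m<lab₁ (proj₂ (inRange i₁ j₁)))
    i : Fin n
    i = proj₁ found
    j : Fin 5
    j = proj₁ (proj₂ found)
    labᵢⱼ : lab T i j ≡ suc m
    labᵢⱼ = proj₂ (proj₂ found)
    a : ℕ
    a = toℕ i
    smaller⇒filled : ∀ i′ j′ → lab T i′ j′ < lab T i j → Filled L i′ j′
    smaller⇒filled i′ j′ lt = small⇒filled pre i′ j′ (s≤s⁻¹ (subst (lab T i′ j′ <_) labᵢⱼ lt))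
    unfilled : ¬ Filled L i j
    unfilled filled = <-irrefl refl (subst (_≤ m) labᵢⱼ (filled⇒small pre i j filled))
    at-row-end : toℕ j ≡ L a
    at-row-end with m≤n⇒m<n∨m≡n (≮⇒≥ unfilled)
    ... | inj₂ La≡j = sym La≡j
    ... | inj₁ La<j = ⊥-elim (<-irrefl (toℕ-fromℕ< La<5) (smaller⇒filled i jL (rowIncr i jL j jL<j)))
      where
      La<5 : L a < 5
      La<5 = <-trans La<j (toℕ<n j)
      jL : Fin 5
      jL = fromℕ< La<5
      jL<j : toℕ jL < toℕ j
      jL<j = subst (_< toℕ j) (sym (toℕ-fromℕ< La<5)) La<j
    above-filled : ∀ a′ → a ≡ suc a′ → L a ≤ 3 → L a + 2 ≤ L a′
    above-filled a′ a≡ La≤3 =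
      subst (_≤ L a′) (+-comm 2 (L a)) (subst₂ (λ x y → x < L y) (toℕ-fromℕ< c<5) (toℕ-fromℕ< a′<n) filled-bc)
      where
      a′<a : a′ < a
      a′<a = subst (a′ <_) (sym a≡) ≤-refl
      a′<n : a′ < n
      a′<n = <-trans a′<a (toℕ<n i)
      c<5 : suc (L a) < 5
      c<5 = s≤s (s≤s La≤3)
      b : Fin n
      b = fromℕ< a′<n
      c : Fin 5
      c = fromℕ< c<5
      same-col : col b c ≡ col i j
      same-col = trans (cong₂ _+_ (toℕ-fromℕ< a′<n) (toℕ-fromℕ< c<5))
                   (trans (+-suc a′ (L a)) (trans (cong (_+ L a) (sym a≡)) (cong (_+_ a) (sym at-row-end))))
      filled-bc : Filled L b c
      filled-bc = smaller⇒filled b c (colIncr b c i j (subst (_< a) (sym (toℕ-fromℕ< a′<n)) a′<a) same-col)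

  -- A continuation lists the tableaux completing a state (window, partial
  -- filling, number of labels inserted).
  Continuation : Set
  Continuation = Window → Filling n 5 → ℕ → List (Filling n 5)

  insert : ℕ → Window → Fin 4 → Filling n 5 → ℕ → Filling n 5
  insert f q t P m = write (f + toℕ t) (profile f q (f + toℕ t)) (suc m) P

  -- The enumeration follows the tree of countUntilSlide and count, now
  -- carrying the filling along (f = number of complete rows).
  mutual
    tableauxUntilSlide : ℕ → ℕ → Continuation → ℕ → Continuation
    tableauxUntilSlide R f φ zero q P m = []
    tableauxUntilSlide R f φ (suc k) q P m =
      concatMap (λ t → tableauxBranch R f φ k q P m t (completes t q)) (addableRows R q)

    tableauxBranch : ℕ → ℕ → Continuation → ℕ → Window → Filling n 5 → ℕ → Fin 4 → Bool → List (Filling n 5)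
    tableauxBranch R f φ k q P m t true = φ (slide (grow q t)) (insert f q t P m) (suc m)
    tableauxBranch R f φ k q P m t false = tableauxUntilSlide R f φ k (grow q t) (insert f q t P m) (suc m)

  tableaux : ℕ → ℕ → Continuation
  tableaux zero f q P m = P ∷ []
  tableaux (suc r) f q P m = tableauxUntilSlide (suc r) f (tableaux r (suc f)) 11 q P m

  mutual
    length-tableauxUntilSlide : ∀ R f φ ψ → (∀ q P m → length (φ q P m) ≡ ψ q) →
      ∀ k q P m → length (tableauxUntilSlide R f φ k q P m) ≡ countUntilSlide ψ R k q
    length-tableauxUntilSlide R f φ ψ φ≈ψ zero q P m = refl
    length-tableauxUntilSlide R f φ ψ φ≈ψ (suc k) q P m =
      trans (length-concatMap (λ t → tableauxBranch R f φ k q P m t (completes t q)) (addableRows R q))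
            (cong sum (map-cong (λ t → length-tableauxBranch R f φ ψ φ≈ψ k q P m t (completes t q)) (addableRows R q)))

    length-tableauxBranch : ∀ R f φ ψ → (∀ q P m → length (φ q P m) ≡ ψ q) →
      ∀ k q P m t b → length (tableauxBranch R f φ k q P m t b) ≡ countBranch ψ R k q t b
    length-tableauxBranch R f φ ψ φ≈ψ k q P m t true = φ≈ψ _ _ _
    length-tableauxBranch R f φ ψ φ≈ψ k q P m t false = length-tableauxUntilSlide R f φ ψ φ≈ψ k (grow q t) _ _

  length-tableaux : ∀ r f q P m → length (tableaux r f q P m) ≡ count r q
  length-tableaux zero f q P m = refl
  length-tableaux (suc r) f q P m =
    length-tableauxUntilSlide (suc r) f (tableaux r (suc f)) (count r) (length-tableaux r (suc f)) 11 q P m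

  record Invariant (f R : ℕ) (q : Window) (P : Filling n 5) (m : ℕ) : Set where
    field
      rows       : f + R ≡ n
      wellFormed : WellFormed q
      emptyBelow : EmptyFrom R q
      labelCount : m ≡ 5 * f + size q
      partial    : PartialTableau (profile f q) P m

  open Invariant

  module Insert (r f : ℕ) (q : Window) (P : Filling n 5) (m : ℕ) (inv : Invariant f (suc r) q P m)
                (t : Fin 4) (addable : Addable (suc r) q t) where

    a<n : f + toℕ t < n
    a<n = subst (f + toℕ t <_) (rows inv) (+-monoʳ-< f (proj₁ addable))

    growable : Growable (profile f q) (f + toℕ t)
    growable = addable⇒growable f (suc r) q t (wellFormed inv) addable

    module Grow (incomplete : completes t q ≡ false) where
      open AddBox (profile f q) (profile f (grow q t)) P m (f + toℕ t) a<n growable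
                  (proj₁ (profile-grow f q t)) (proj₂ (profile-grow f q t)) public

      invariant′ : Invariant f (suc r) (grow q t) P′ (suc m)
      invariant′ = record
        { rows = rows inv
        ; wellFormed = wellFormed-grow q t (wellFormed inv) (proj₂ addable) incomplete
        ; emptyBelow = emptyFrom-grow (suc r) q t (emptyBelow inv) (proj₁ addable)
        ; labelCount = filled-grow f q t m (labelCount inv)
        ; partial = extend (partial inv) }

  module Slide (r f : ℕ) (q : Window) (P : Filling n 5) (m : ℕ) (inv : Invariant f (suc r) q P m)
               (addable : Addable (suc r) q zero) (top≡4 : rowLength q 0 ≡ 4) where
    open Insert r f q P m inv zero addable using (a<n; growable)

    open AddBox (profile f q) (profile (suc f) (slide (grow q zero))) P m (f + 0) a<n growable
                (subst (λ x → profile (suc f) _ x ≡ suc (profile f q x)) (sym (+-identityʳ f)) (proj₁ (profile-slide f q top≡4)))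
                (λ x x≢ → proj₂ (profile-slide f q top≡4) x (x≢ ∘ flip trans (sym (+-identityʳ f)))) public

    invariant′ : Invariant (suc f) r (slide (grow q zero)) P′ (suc m)
    invariant′ = record
      { rows = trans (sym (+-suc f r)) (rows inv)
      ; wellFormed = wellFormed-slide q (wellFormed inv)
      ; emptyBelow = emptyFrom-slide r (grow q zero) (emptyFrom-grow (suc r) q zero (emptyBelow inv) (proj₁ addable))
      ; labelCount = filled-slide f q m top≡4 (labelCount inv)
      ; partial = extend (partial inv) }

  addable-of : ∀ {R q t} → t ∈ addableRows R q → Addable R q t
  addable-of {R} {q} t∈ = proj₂ (∈-filter⁻ (addable? R q) {xs = allFin 4} t∈)

  SoundContinuation : ℕ → ℕ → Continuation → Set
  SoundContinuation r f φ = ∀ q P m → Invariant (suc f) r q P m → ∀ X → X ∈ φ q P m → Extends (profile (suc f) q) P X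

  mutual
    sound-untilSlide : ∀ r f φ → SoundContinuation r f φ → ∀ k q P m → Invariant f (suc r) q P m →
      ∀ X → X ∈ tableauxUntilSlide (suc r) f φ k q P m → Extends (profile f q) P X
    sound-untilSlide r f φ φ-sound zero q P m inv X ()
    sound-untilSlide r f φ φ-sound (suc k) q P m inv X X∈ with find (∈-concatMap⁻ _ {xs = addableRows (suc r) q} X∈)
    ... | t , t∈ , X∈t = proj₁ (sound-branch r f φ φ-sound k q P m inv t (addable-of t∈) X (completes t q) refl X∈t)

    sound-branch : ∀ r f φ → SoundContinuation r f φ → ∀ k q P m → Invariant f (suc r) q P m → ∀ t → Addable (suc r) q t →
      ∀ X b → completes t q ≡ b → X ∈ tableauxBranch (suc r) f φ k q P m t b →
      Extends (profile f q) P X × Σ (Fin n) λ i → Σ (Fin 5) λ j → toℕ i ≡ f + toℕ t × lab X i j ≡ suc m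
    sound-branch r f φ φ-sound k q P m inv t addable X false incomplete X∈ =
      extends-via-new X (sound-untilSlide r f φ φ-sound k (grow q t) P′ (suc m) invariant′ X X∈)
      where open Insert r f q P m inv t addable
            open Grow incomplete
    sound-branch r f φ φ-sound k q P m inv t addable X true completing X∈ with completes-true t q completing
    ... | refl , top≡4 = extends-via-new X (φ-sound _ P′ (suc m) invariant′ X X∈)
      where open Slide r f q P m inv addable top≡4


  all-filled : ∀ f q i j → f ≡ n → Filled (profile f q) i j
  all-filled f q i j f≡n =
    subst (toℕ j <_) (sym (profile-above f q (toℕ i) (subst (toℕ i <_) (sym f≡n) (toℕ<n i)))) (toℕ<n j)

  final-tableau : ∀ f q P m → Invariant f 0 q P m → IsSYT P
  final-tableau f q P m inv = record
    { inRange = λ i j → subst (λ x → 1 ≤ lab P i j × lab P i j ≤ x) m≡n*5 (inRange C i j (filled i j))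
    ; injective = λ i j i′ j′ → injective C i j i′ j′ (filled i j) (filled i′ j′)
    ; surjective = λ v 1≤v v≤n*5 →
        let i , j , _ , labv = surjective C v 1≤v (subst (v ≤_) (sym m≡n*5) v≤n*5) in i , j , labv
    ; rowIncr = λ i j j′ → rowIncr C i j j′ (filled i j′)
    ; colIncr = λ i j i′ j′ → colIncr C i j i′ j′ (filled i′ j′) }
    where
    open PartialTableau
    C : PartialTableau (profile f q) P m
    C = partial inv
    f≡n : f ≡ n
    f≡n = trans (sym (+-identityʳ f)) (rows inv)
    filled : ∀ i j → Filled (profile f q) i j
    filled i j = all-filled f q i j f≡n
    m≡n*5 : m ≡ n * 5
    m≡n*5 = begin
        m
      ≡⟨ labelCount inv ⟩
        5 * f + size q
      ≡⟨ cong₂ _+_ (cong (5 *_) f≡n) (emptyFrom0-size q (emptyBelow inv)) ⟩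
        5 * n + 0
      ≡⟨ trans (+-identityʳ (5 * n)) (*-comm 5 n) ⟩
        n * 5
      ∎

  sound : ∀ r f q P m → Invariant f r q P m → ∀ X → X ∈ tableaux r f q P m → Extends (profile f q) P X
  sound zero f q P m inv X (here refl) = final-tableau f q P m inv , λ i j _ → refl
  sound (suc r) f q P m inv X X∈ =
    sound-untilSlide r f (tableaux r (suc f)) (sound r (suc f)) 11 q P m inv X X∈

  module Complete (T : Filling n 5) (syt : IsSYT T) where

    CompleteContinuation : ℕ → ℕ → Continuation → Set
    CompleteContinuation r f φ = ∀ q P m → Invariant (suc f) r q P m → Prefix T (profile (suc f) q) P m → T ∈ φ q P m

    mutual
      -- The fuel k + size q ≥ 11 suffices: every insertion grows the window,
      -- whose size stays ≤ 10 until its top row is completed.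
      complete-untilSlide : ∀ r f φ → CompleteContinuation r f φ → ∀ k q P m → 11 ≤ k + size q →
        Invariant f (suc r) q P m → Prefix T (profile f q) P m → T ∈ tableauxUntilSlide (suc r) f φ k q P m
      complete-untilSlide r f φ φ-complete zero q P m fuel inv pre =
        ⊥-elim (<-irrefl refl (≤-trans fuel (wellFormed-size q (wellFormed inv))))
      complete-untilSlide r f φ φ-complete (suc k) q P m fuel inv pre =
        ∈-concatMap⁺ _ {xs = addableRows (suc r) q}
          (lose t∈ (complete-branch r f φ φ-complete k q P m fuel inv pre t addable i j position′ label (completes t q) refl))
        where
        f<n : f < n
        f<n = subst (f <_) (rows inv) (subst (_≤ f + suc r) (+-comm f 1) (+-monoʳ-≤ f (s≤s z≤n)))
        unfilled : ¬ Filled (profile f q) (fromℕ< f<n) (fromℕ 4)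
        unfilled filled = <-irrefl refl (≤-trans (subst (4 <_) top filled) (s≤s⁻¹ (wellFormed-row<5 q 0 (wellFormed inv))))
          where
          top : profile f q (toℕ (fromℕ< f<n)) ≡ rowLength q 0
          top = trans (cong (profile f q) (trans (toℕ-fromℕ< f<n) (sym (+-identityʳ f)))) (profile-window f q 0)
        next : NextBox T (profile f q) m
        next = next-box T (profile f q) P m syt pre (fromℕ< f<n) (fromℕ 4) unfilled
        open NextBox next using (i; j; label) renaming (row to a)
        row : Σ (Fin 4) λ t → Addable (suc r) q t × f + toℕ t ≡ a
        row = growable⇒addable f (suc r) q a (wellFormed inv) (subst (a <_) (sym (rows inv)) (NextBox.row<n next))
                (NextBox.growable next)
        t : Fin 4
        t = proj₁ row
        addable : Addable (suc r) q t
        addable = proj₁ (proj₂ row)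
        f+t≡a : f + toℕ t ≡ a
        f+t≡a = proj₂ (proj₂ row)
        position′ : toℕ i ≡ f + toℕ t × toℕ j ≡ profile f q (f + toℕ t)
        position′ = let i≡a , j≡La = NextBox.position next in
          trans i≡a (sym f+t≡a) , trans j≡La (cong (profile f q) (sym f+t≡a))
        t∈ : t ∈ addableRows (suc r) q
        t∈ = ∈-filter⁺ (addable? (suc r) q) {xs = allFin 4} (∈-allFin t) addable

      complete-branch : ∀ r f φ → CompleteContinuation r f φ → ∀ k q P m → 11 ≤ suc k + size q →
        Invariant f (suc r) q P m → Prefix T (profile f q) P m → ∀ t → Addable (suc r) q t →
        ∀ i j → toℕ i ≡ f + toℕ t × toℕ j ≡ profile f q (f + toℕ t) → lab T i j ≡ suc m →
        ∀ b → completes t q ≡ b → T ∈ tableauxBranch (suc r) f φ k q P m t b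
      complete-branch r f φ φ-complete k q P m fuel inv pre t addable i j new labᵢⱼ false incomplete =
        complete-untilSlide r f φ φ-complete k (grow q t) P′ (suc m) fuel′ invariant′ (extend-prefix T syt pre i j new labᵢⱼ)
        where
        open Insert r f q P m inv t addable
        open Grow incomplete
        fuel′ : 11 ≤ k + size (grow q t)
        fuel′ = subst (11 ≤_) (trans (sym (+-suc k (size q))) (cong (_+_ k) (sym (size-grow q t)))) fuel
      complete-branch r f φ φ-complete k q P m fuel inv pre t addable i j new labᵢⱼ true completing
        with completes-true t q completing
      ... | refl , top≡4 = φ-complete _ P′ (suc m) invariant′ (extend-prefix T syt pre i j new labᵢⱼ)
        where open Slide r f q P m inv addable top≡4

    complete : ∀ r f q P m → Invariant f r q P m → Prefix T (profile f q) P m → T ∈ tableaux r f q P m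
    complete zero f q P m inv pre =
      here (filling-ext T P λ i j → sym (agrees pre i j (all-filled f q i j (trans (sym (+-identityʳ f)) (rows inv)))))
    complete (suc r) f q P m inv pre =
      complete-untilSlide r f (tableaux r (suc f)) (complete r (suc f)) 11 q P m (m≤m+n 11 (size q)) inv pre

  UniqueContinuation : ℕ → ℕ → Continuation → Set
  UniqueContinuation r f φ = ∀ q P m → Invariant (suc f) r q P m → Unique (φ q P m)

  -- Uniqueness: different branches put the next label into different rows,
  -- so they list different tableaux.
  mutual
    unique-untilSlide : ∀ r f φ → SoundContinuation r f φ → UniqueContinuation r f φ →
      ∀ k q P m → Invariant f (suc r) q P m → Unique (tableauxUntilSlide (suc r) f φ k q P m)
    unique-untilSlide r f φ φ-sound φ-unique zero q P m inv = AllPairs.[]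
    unique-untilSlide r f φ φ-sound φ-unique (suc k) q P m inv =
      unique-concatMap branch (addableRows (suc r) q) (UniqueProps.filter⁺ (addable? (suc r) q) (UniqueProps.allFin⁺ 4))
        (λ t t∈ → unique-branch r f φ φ-sound φ-unique k q P m inv t (addable-of t∈) (completes t q) refl)
        disjoint
      where
      branch : Fin 4 → List (Filling n 5)
      branch t = tableauxBranch (suc r) f φ k q P m t (completes t q)
      disjoint : ∀ t t′ → t ∈ addableRows (suc r) q → t′ ∈ addableRows (suc r) q →
        ∀ X → X ∈ branch t → X ∈ branch t′ → t ≡ t′
      disjoint t t′ t∈ t′∈ X X∈ X∈′
        with sound-branch r f φ φ-sound k q P m inv t (addable-of t∈) X (completes t q) refl X∈
           | sound-branch r f φ φ-sound k q P m inv t′ (addable-of t′∈) X (completes t′ q) refl X∈′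
      ... | (syt , _) , i , j , i≡ , labᵢⱼ | _ , i′ , j′ , i′≡ , labᵢ′ⱼ′
        with IsSYT.injective syt i j i′ j′ (trans labᵢⱼ (sym labᵢ′ⱼ′))
      ...   | refl , refl = toℕ-injective (+-cancelˡ-≡ f (toℕ t) (toℕ t′) (trans (sym i≡) i′≡))

    unique-branch : ∀ r f φ → SoundContinuation r f φ → UniqueContinuation r f φ →
      ∀ k q P m → Invariant f (suc r) q P m → ∀ t → Addable (suc r) q t →
      ∀ b → completes t q ≡ b → Unique (tableauxBranch (suc r) f φ k q P m t b)
    unique-branch r f φ φ-sound φ-unique k q P m inv t addable false incomplete =
      unique-untilSlide r f φ φ-sound φ-unique k (grow q t) P′ (suc m) invariant′
      where open Insert r f q P m inv t addable
            open Grow incomplete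
    unique-branch r f φ φ-sound φ-unique k q P m inv t addable true completing
      with completes-true t q completing
    ... | refl , top≡4 = φ-unique _ P′ (suc m) invariant′
      where open Slide r f q P m inv addable top≡4

  unique : ∀ r f q P m → Invariant f r q P m → Unique (tableaux r f q P m)
  unique zero f q P m inv = All.[] AllPairs.∷ AllPairs.[]
  unique (suc r) f q P m inv =
    unique-untilSlide r f (tableaux r (suc f)) (sound r (suc f)) (unique r (suc f)) 11 q P m inv

  emptyFilling : Filling n 5
  emptyFilling = replicate n (replicate 5 0)

  nothing-filled : ∀ i j → ¬ Filled (profile 0 emptyWindow) i j
  nothing-filled i j filled = n≮0 (subst (toℕ j <_) (rowLength-empty (toℕ i)) filled)

  initial : Invariant 0 n emptyWindow emptyFilling 0
  initial = record
    { rows = refl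
    ; wellFormed = z≤n , z≤n , z≤n , z≤n , (λ ()) , (λ ()) , (λ ())
    ; emptyBelow = λ y _ → rowLength-empty y
    ; labelCount = refl
    ; partial = record
      { inRange = λ i j filled → ⊥-elim (nothing-filled i j filled)
      ; injective = λ i j _ _ filled _ _ → ⊥-elim (nothing-filled i j filled)
      ; surjective = λ v 1≤v v≤0 → ⊥-elim (<-irrefl refl (≤-trans 1≤v v≤0))
      ; rowIncr = λ i _ j′ filled _ → ⊥-elim (nothing-filled i j′ filled)
      ; colIncr = λ _ _ i′ j′ filled _ _ → ⊥-elim (nothing-filled i′ j′ filled)
      ; colClosed = λ _ _ i′ j′ filled _ _ → ⊥-elim (nothing-filled i′ j′ filled) } }

  initial-prefix : ∀ T → IsSYT T → Prefix T (profile 0 emptyWindow) emptyFilling 0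
  initial-prefix T syt = record
    { agrees = λ i j filled → ⊥-elim (nothing-filled i j filled)
    ; small⇒filled = λ i j ≤0 → ⊥-elim (<-irrefl refl (≤-trans (proj₁ (IsSYT.inRange syt i j)) ≤0))
    ; filled⇒small = λ i j filled → ⊥-elim (nothing-filled i j filled) }

  allTableaux : List (Filling n 5)
  allTableaux = tableaux n 0 emptyWindow emptyFilling 0

  allTableaux-unique : Unique allTableaux
  allTableaux-unique = unique n 0 emptyWindow emptyFilling 0 initial

  allTableaux-length : length allTableaux ≡ count n emptyWindow
  allTableaux-length = length-tableaux n 0 emptyWindow emptyFilling 0

  allTableaux-complete : ∀ T → IsSYT T → T ∈ allTableaux
  allTableaux-complete T syt = Complete.complete T syt n 0 emptyWindow emptyFilling 0 initial (initial-prefix T syt)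

  allTableaux-sound : ∀ T → T ∈ allTableaux → IsSYT T
  allTableaux-sound T T∈ = proj₁ (sound n 0 emptyWindow emptyFilling 0 initial T T∈)

theorem3 : Σ (ℕ → ℕ) λ g →
    (∀ n → 1 ≤ n → Σ (List (Filling n 5)) λ L →
        Unique L × length L ≡ g n
        × (∀ T → (IsSYT T → T ∈ L) × (T ∈ L → IsSYT T)))
    × g 1 ≡ 1 × g 2 ≡ 14 × g 3 ≡ 290
    × (∀ n → 4 ≤ n →
        + g n ≡ (+ 24) *ℤ (+ g (n ∸ 1)) - (+ 40) *ℤ (+ g (n ∸ 2)) - (+ 8) *ℤ (+ g (n ∸ 3)))
theorem3 =
  tableauCount ,
  (λ n _ → let open Tableaux n in
     allTableaux , allTableaux-unique ,
     trans allTableaux-length (sym (arrivalCount-unfold n zero)) ,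
     λ T → allTableaux-complete T , allTableaux-sound T) ,
  tableauCount-1 , tableauCount-2 , tableauCount-3 ,
  recurrence
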